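{- For every integer $m \geq 1$ and every integer $l$ with $0 \leq l \leq m$, \[ \nu_{2}(A_{l,m}) = \nu_{2}\big((m+1-l)_{2l}\big) + l, \] where $(a)_{k} = a(a+1)\cdots(a+k-1)$ is the Pochhammer symbol (with $(a)_0=1$).
   Context: For integers $m \geq 1$ and $0 \leq l \leq m$ define \[ A_{l,m} = \frac{l!\, m!}{2^{m-l}} \sum_{k=l}^{m} 2^{k} \binom{2m-2k}{m-k}\binom{m+k}{m}\binom{k}{l}. \] These numbers are integers. For a nonzero integer $x$, $\nu_2(x)$ denotes the $2$-adic valuation of $x$, i.e. the exponent of the highest power of $2$ dividing $x$. -}

module Defs where

open import Data.Nat using (ℕ; zero; suc; _+_; _*_; _∸_; _^_; _!)
open import Data.Nat.DivMod using (_/_)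
open import Data.Nat.Divisibility using (_∣_)
open import Data.Nat.Combinatorics using (_C_)
open import Data.Product using (_×_)
open import Relation.Nullary using (¬_)

sumFromTo : ℕ → ℕ → (ℕ → ℕ) → ℕ
sumFromTo l m f = go (suc m ∸ l)
  where
  go : ℕ → ℕ
  go zero    = 0
  go (suc j) = f (l + j) + go j

innerSum : ℕ → ℕ → ℕ
innerSum l m = sumFromTo l m (λ k → 2 ^ k * ((2 * m ∸ 2 * k) C (m ∸ k)) * ((m + k) C m) * (k C l))

-- A_{l,m} = l! m! / 2^{m-l} * innerSum  (the numerator is divisible by 2^{m-l};
-- exact division in ℕ)
A : ℕ → ℕ → ℕ
A l m = ((l ! * m ! * innerSum l m) / (2 ^ (m ∸ l))) {{nz}}
  where
  open import Data.Nat using (NonZero)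
  open import Data.Nat.Properties using (m^n≢0)
  nz : NonZero (2 ^ (m ∸ l))
  nz = m^n≢0 2 (m ∸ l)

poch : ℕ → ℕ → ℕ
poch a zero    = 1
poch a (suc k) = poch a k * (a + k)

-- ν₂(x) = v  : 2^v divides x and 2^(v+1) does not (x nonzero is then forced)
IsNu2 : ℕ → ℕ → Set
IsNu2 x v = (2 ^ v ∣ x) × ¬ (2 ^ suc v ∣ x)

{-# OPTIONS --safe #-}
-- Write m = l + n.  Substituting k = l + i, each summand of A l m factors as
--   l! m! 2^k C(2m-2k, m-k) C(m+k, m) C(k, l)
--     = 2^m (n+1)_{2l} · (2j-1)!! C(n, i) (m+l+1)_i      (j = n - i),
-- so A l m = 2^l (n+1)_{2l} B with B = Σ_i (2j-1)!! C(n, i) (m+l+1)_i.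
-- The i = 0 term of B is the odd number (2n-1)!!, the i = 1 term contains
-- n (n + 2l + 1) and every later term contains a product of two consecutive
-- integers, so B is odd and ν₂(A l m) = ν₂((n+1)_{2l}) + l.
module Submission where

open import Defs
open import Data.Nat
open import Data.Nat.Properties
open import Data.Nat.Combinatorics using (_C_; nC1≡n; nCk≡n!/k![n-k]!; k![n∸k]!∣n!)
open import Data.Nat.DivMod using (m/n*n≡m; m*n/n≡m)
open import Data.Nat.Divisibility
open import Data.Nat.Primality using (Prime; prime[2]; prime⇒nonZero; euclidsLemma)
open import Data.Nat.Tactic.RingSolver using (solve-∀)
open import Data.Product using (_,_)
open import Data.Sum using (inj₁; inj₂; [_,_])
open import Function using (_∘_)
open import Relation.Nullary using (contradiction)
open import Relation.Binary.PropositionalEquality hiding ([_])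

open ≡-Reasoning

[m+n]Cm*m!*n!≡[m+n]! : ∀ m n → ((m + n) C m) * (m ! * n !) ≡ (m + n) !
[m+n]Cm*m!*n!≡[m+n]! m n = begin
  ((m + n) C m) * (m ! * n !)
    ≡⟨ cong (λ k → ((m + n) C m) * (m ! * k !)) (m+n∸m≡n m n) ⟨
  ((m + n) C m) * (m ! * (m + n ∸ m) !)
    ≡⟨ cong (_* (m ! * (m + n ∸ m) !)) (nCk≡n!/k![n-k]! (m≤m+n m n)) ⟩
  (m + n) ! / (m ! * (m + n ∸ m) !) * (m ! * (m + n ∸ m) !)
    ≡⟨ m/n*n≡m (k![n∸k]!∣n! (m≤m+n m n)) ⟩
  (m + n) !
    ∎
  where instance _ = m !* (m + n ∸ m) !≢0

poch[1+m,n]*m!≡[m+n]! : ∀ m n → poch (suc m) n * m ! ≡ (m + n) !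
poch[1+m,n]*m!≡[m+n]! m zero    = trans (+-identityʳ (m !)) (cong _! (sym (+-identityʳ m)))
poch[1+m,n]*m!≡[m+n]! m (suc n) = begin
  poch (suc m) n * suc (m + n) * m !   ≡⟨ rearrange (poch (suc m) n) (suc (m + n)) (m !) ⟩
  suc (m + n) * (poch (suc m) n * m !) ≡⟨ cong (suc (m + n) *_) (poch[1+m,n]*m!≡[m+n]! m n) ⟩
  suc (m + n) !                        ≡⟨ cong _! (+-suc m n) ⟨
  (m + suc n) !                        ∎
  where
  rearrange : ∀ p s f → p * s * f ≡ s * (p * f)
  rearrange = solve-∀

oddFactorial : ℕ → ℕ
oddFactorial zero    = 1
oddFactorial (suc n) = oddFactorial n * suc (2 * n)

2^n*oddFactorial[n]*n!≡[2n]! : ∀ n → 2 ^ n * oddFactorial n * n ! ≡ (2 * n) !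
2^n*oddFactorial[n]*n!≡[2n]! zero    = refl
2^n*oddFactorial[n]*n!≡[2n]! (suc n) = begin
  2 * 2 ^ n * (oddFactorial n * suc (2 * n)) * (suc n * n !)
    ≡⟨ rearrange (2 ^ n) (oddFactorial n) (n !) n ⟩
  (2 + 2 * n) * (suc (2 * n) * (2 ^ n * oddFactorial n * n !))
    ≡⟨ cong (λ f → (2 + 2 * n) * (suc (2 * n) * f)) (2^n*oddFactorial[n]*n!≡[2n]! n) ⟩
  (2 + 2 * n) !
    ≡⟨ cong _! (*-suc 2 n) ⟨
  (2 * suc n) !
    ∎
  where
  rearrange : ∀ p o f n → 2 * p * (o * suc (2 * n)) * (suc n * f) ≡ (2 + 2 * n) * (suc (2 * n) * (p * o * f))
  rearrange = solve-∀

2∤1+2n : ∀ n → 2 ∤ suc (2 * n)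
2∤1+2n n (divides q 1+2n≡q*2) = even≢odd q n (trans (*-comm 2 q) (sym 1+2n≡q*2))

2∣n*[1+n] : ∀ n → 2 ∣ n * suc n
2∣n*[1+n] zero    = divides 0 refl
2∣n*[1+n] (suc n) = subst (2 ∣_) (expand n) (∣m∣n⇒∣m+n (2∣n*[1+n] n) (m∣m*n (suc n)))
  where
  expand : ∀ n → n * suc n + 2 * suc n ≡ suc n * suc (suc n)
  expand = solve-∀

∣m∧∤n⇒∤m+n : ∀ {d m n} → d ∣ m → d ∤ n → d ∤ m + n
∣m∧∤n⇒∤m+n d∣m d∤n d∣m+n = d∤n (∣m+n∣m⇒∣n d∣m+n d∣m)

prime∤m∧∤n⇒∤m*n : ∀ {p m n} → Prime p → p ∤ m → p ∤ n → p ∤ m * n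
prime∤m∧∤n⇒∤m*n {m = m} {n} p-prime p∤m p∤n p∣m*n = [ p∤m , p∤n ] (euclidsLemma m n p-prime p∣m*n)

prime^k∣m*n∧∤n⇒^k∣m : ∀ {p m n} → Prime p → ∀ k → p ^ k ∣ m * n → p ∤ n → p ^ k ∣ m
prime^k∣m*n∧∤n⇒^k∣m         p-prime zero    _ _ = 1∣ _
prime^k∣m*n∧∤n⇒^k∣m {p} {m} {n} p-prime (suc k) p^[1+k]∣m*n p∤n
  with euclidsLemma m n p-prime (m*n∣⇒m∣ p (p ^ k) p^[1+k]∣m*n)
... | inj₂ p∣n = contradiction p∣n p∤n
... | inj₁ (divides q refl) = subst (p * p ^ k ∣_) (*-comm p q) (*-monoʳ-∣ p p^k∣q)
  where
  instance _ = prime⇒nonZero p-prime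
  p^k∣q : p ^ k ∣ q
  p^k∣q = prime^k∣m*n∧∤n⇒^k∣m p-prime k
    (*-cancelˡ-∣ p (subst (p * p ^ k ∣_) (swap q p n) p^[1+k]∣m*n)) p∤n
    where
    swap : ∀ q p n → q * p * n ≡ p * (q * n)
    swap = solve-∀

IsNu2-*-odd : ∀ {x v b} → IsNu2 x v → 2 ∤ b → IsNu2 (x * b) v
IsNu2-*-odd {v = v} {b} (2^v∣x , 2^[1+v]∤x) 2∤b =
  ∣m⇒∣m*n b 2^v∣x , λ 2^[1+v]∣x*b → 2^[1+v]∤x (prime^k∣m*n∧∤n⇒^k∣m prime[2] (suc v) 2^[1+v]∣x*b 2∤b)

IsNu2-2^l* : ∀ {x v} l → IsNu2 x v → IsNu2 (2 ^ l * x) (v + l)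
IsNu2-2^l* {x} {v} l (2^v∣x , 2^[1+v]∤x) =
  subst (_∣ 2 ^ l * x) (sym (2^[u+l]≡2^l*2^u v)) (*-monoʳ-∣ (2 ^ l) 2^v∣x) ,
  λ 2^[1+v+l]∣2^l*x → 2^[1+v]∤x
    (*-cancelˡ-∣ (2 ^ l) {{m^n≢0 2 l}} (subst (_∣ 2 ^ l * x) (2^[u+l]≡2^l*2^u (suc v)) 2^[1+v+l]∣2^l*x))
  where
  2^[u+l]≡2^l*2^u : ∀ u → 2 ^ (u + l) ≡ 2 ^ l * 2 ^ u
  2^[u+l]≡2^l*2^u u = trans (^-distribˡ-+-* 2 u l) (*-comm (2 ^ u) (2 ^ l))

sumBelow : ℕ → (ℕ → ℕ) → ℕ
sumBelow zero    f = 0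
sumBelow (suc n) f = f n + sumBelow n f

sumBelow-unique : ∀ {f g : ℕ → ℕ} → g 0 ≡ 0 → (∀ n → g (suc n) ≡ f n + g n) → ∀ n → g n ≡ sumBelow n f
sumBelow-unique g0≡0 gsuc zero    = g0≡0
sumBelow-unique g0≡0 gsuc (suc n) = trans (gsuc n) (cong (_ +_) (sumBelow-unique g0≡0 gsuc n))

-- Abstracting suc m ∸ l turns the goal into the recursion equations of sumFromTo's local loop.
sumFromTo≡sumBelow : ∀ l m f → sumFromTo l m f ≡ sumBelow (suc m ∸ l) (f ∘ (l +_))
sumFromTo≡sumBelow l m f with suc m ∸ l | sumBelow-unique {f ∘ (l +_)} refl (λ _ → refl)
... | n | unique = unique n

sumFromTo[l,l+n]≡sumBelow : ∀ l n f → sumFromTo l (l + n) f ≡ sumBelow (suc n) (f ∘ (l +_))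
sumFromTo[l,l+n]≡sumBelow l n f = trans (sumFromTo≡sumBelow l (l + n) f)
  (cong (λ k → sumBelow k (f ∘ (l +_))) (trans (cong (_∸ l) (sym (+-suc l n))) (m+n∸m≡n l (suc n))))

*-sumBelow-cong : ∀ a b {f g} n → (∀ i → i < n → a * f i ≡ b * g i) → a * sumBelow n f ≡ b * sumBelow n g
*-sumBelow-cong a b         zero    _  = trans (*-zeroʳ a) (sym (*-zeroʳ b))
*-sumBelow-cong a b {f} {g} (suc n) eq = begin
  a * (f n + sumBelow n f)          ≡⟨ *-distribˡ-+ a (f n) (sumBelow n f) ⟩
  a * f n + a * sumBelow n f        ≡⟨ cong₂ _+_ (eq n ≤-refl) (*-sumBelow-cong a b n (λ i i<n → eq i (m≤n⇒m≤1+n i<n))) ⟩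
  b * g n + b * sumBelow n g        ≡⟨ *-distribˡ-+ b (g n) (sumBelow n g) ⟨
  b * (g n + sumBelow n g)          ∎

sumBelow-odd : ∀ {f} n → 2 ∤ f 0 → (∀ i → i < n → 2 ∣ f (suc i)) → 2 ∤ sumBelow (suc n) f
sumBelow-odd {f} zero    2∤f0 _    = subst (2 ∤_) (sym (+-identityʳ (f 0))) 2∤f0
sumBelow-odd     (suc n) 2∤f0 even =
  ∣m∧∤n⇒∤m+n (even n ≤-refl) (sumBelow-odd n 2∤f0 (λ i i<n → even i (m≤n⇒m≤1+n i<n)))

summand : ℕ → ℕ → ℕ → ℕ
summand l m k = 2 ^ k * ((2 * m ∸ 2 * k) C (m ∸ k)) * ((m + k) C m) * (k C l)

reducedSummand : ℕ → ℕ → ℕ → ℕ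
reducedSummand l n i = oddFactorial (n ∸ i) * (n C i) * poch (suc (l + n + l)) i

-- Both sides of the factorisation, multiplied by j! j! k! i!, become 2^k (2j)! (m+k)! k!.
module SummandFactorisation (l i j : ℕ) where

  m k : ℕ
  m = l + (i + j)
  k = l + i

  m≡k+j : m ≡ k + j
  m≡k+j = sym (+-assoc l i j)

  m∸k≡j : m ∸ k ≡ j
  m∸k≡j = trans (cong (_∸ k) m≡k+j) (m+n∸m≡n k j)

  scale : ℕ
  scale = j ! * j ! * k ! * i !

  common : ℕ
  common = 2 ^ k * (2 * j) ! * (m + k) ! * k !

  [2j]Cj*j!*j!≡[2j]! : ((2 * j) C j) * (j ! * j !) ≡ (2 * j) !
  [2j]Cj*j!*j!≡[2j]! = subst (λ t → (t C j) * (j ! * j !) ≡ t !) (cong (j +_) (sym (+-identityʳ j)))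
    ([m+n]Cm*m!*n!≡[m+n]! j j)

  summand*scale : l ! * m ! * summand l m k * scale ≡ common
  summand*scale = begin
    l ! * m ! * (2 ^ k * ((2 * m ∸ 2 * k) C (m ∸ k)) * c₂ * c₃) * scale
      ≡⟨ cong (λ c → l ! * m ! * (2 ^ k * c * c₂ * c₃) * scale)
           (cong₂ _C_ (trans (sym (*-distribˡ-∸ 2 m k)) (cong (2 *_) m∸k≡j)) m∸k≡j) ⟩
    l ! * m ! * (2 ^ k * c₁ * c₂ * c₃) * scale
      ≡⟨ rearrange (l !) (m !) (2 ^ k) c₁ c₂ c₃ (j !) (k !) (i !) ⟩
    2 ^ k * (c₁ * (j ! * j !)) * (c₂ * (m ! * k !)) * (c₃ * (l ! * i !))
      ≡⟨ cong₂ (λ x y → 2 ^ k * x * y * (c₃ * (l ! * i !))) [2j]Cj*j!*j!≡[2j]! ([m+n]Cm*m!*n!≡[m+n]! m k) ⟩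
    2 ^ k * (2 * j) ! * (m + k) ! * (c₃ * (l ! * i !))
      ≡⟨ cong (2 ^ k * (2 * j) ! * (m + k) ! *_) ([m+n]Cm*m!*n!≡[m+n]! l i) ⟩
    common
      ∎
    where
    c₁ = (2 * j) C j
    c₂ = (m + k) C m
    c₃ = k C l
    rearrange : ∀ lf mf p a b c jf kf if →
      lf * mf * (p * a * b * c) * (jf * jf * kf * if) ≡ p * (a * (jf * jf)) * (b * (mf * kf)) * (c * (lf * if))
    rearrange = solve-∀

  reducedSummand*scale : 2 ^ m * poch (suc (i + j)) (2 * l) * reducedSummand l (i + j) i * scale ≡ common
  reducedSummand*scale = begin
    2 ^ m * P * (oddFactorial (i + j ∸ i) * c * Q) * scale
      ≡⟨ cong₂ (λ x o → x * P * (oddFactorial o * c * Q) * scale)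
           (trans (cong (2 ^_) m≡k+j) (^-distribˡ-+-* 2 k j)) (m+n∸m≡n i j) ⟩
    2 ^ k * 2 ^ j * P * (oddFactorial j * c * Q) * scale
      ≡⟨ rearrange (2 ^ k) (2 ^ j) P (oddFactorial j) c Q (j !) (k !) (i !) ⟩
    2 ^ k * (2 ^ j * oddFactorial j * j !) * (Q * (P * (c * (i ! * j !)))) * k !
      ≡⟨ cong₂ (λ x y → 2 ^ k * x * (Q * (P * y)) * k !) (2^n*oddFactorial[n]*n!≡[2n]! j) ([m+n]Cm*m!*n!≡[m+n]! i j) ⟩
    2 ^ k * (2 * j) ! * (Q * (P * (i + j) !)) * k !
      ≡⟨ cong (λ y → 2 ^ k * (2 * j) ! * y * k !) (begin
           Q * (P * (i + j) !)      ≡⟨ cong (Q *_) (trans (poch[1+m,n]*m!≡[m+n]! (i + j) (2 * l)) (cong _! (i+j+2l≡m+l l i j))) ⟩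
           Q * (m + l) !            ≡⟨ poch[1+m,n]*m!≡[m+n]! (m + l) i ⟩
           (m + l + i) !            ≡⟨ cong _! (+-assoc m l i) ⟩
           (m + k) !                ∎) ⟩
    common
      ∎
    where
    P = poch (suc (i + j)) (2 * l)
    c = (i + j) C i
    Q = poch (suc (m + l)) i
    i+j+2l≡m+l : ∀ l i j → i + j + 2 * l ≡ l + (i + j) + l
    i+j+2l≡m+l = solve-∀
    rearrange : ∀ x y p o c q jf kf if →
      x * y * p * (o * c * q) * (jf * jf * kf * if) ≡ x * (y * o * jf) * (q * (p * (c * (if * jf)))) * kf
    rearrange = solve-∀

  factorisation : l ! * m ! * summand l m k ≡ 2 ^ m * poch (suc (i + j)) (2 * l) * reducedSummand l (i + j) i
  factorisation = *-cancelʳ-≡ _ _ scale {{scale≢0}} (trans summand*scale (sym reducedSummand*scale))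
    where
    scale≢0 : NonZero scale
    scale≢0 = m*n≢0 _ _ {{m*n≢0 _ _ {{j !* j !≢0}} {{k !≢0}}}} {{i !≢0}}

summand-factorisation : ∀ l n i → i ≤ n →
  l ! * (l + n) ! * summand l (l + n) (l + i) ≡ 2 ^ (l + n) * poch (suc n) (2 * l) * reducedSummand l n i
summand-factorisation l n i i≤n with m≤n⇒∃[o]m+o≡n i≤n
... | j , refl = SummandFactorisation.factorisation l i j

reducedSum : ℕ → ℕ → ℕ
reducedSum l n = sumBelow (suc n) (reducedSummand l n)

numerator-factorisation : ∀ l n →
  l ! * (l + n) ! * innerSum l (l + n) ≡ 2 ^ (l + n) * poch (suc n) (2 * l) * reducedSum l n
numerator-factorisation l n = begin
  l ! * (l + n) ! * innerSum l (l + n)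
    ≡⟨ cong (l ! * (l + n) ! *_) (sumFromTo[l,l+n]≡sumBelow l n (summand l (l + n))) ⟩
  l ! * (l + n) ! * sumBelow (suc n) (summand l (l + n) ∘ (l +_))
    ≡⟨ *-sumBelow-cong (l ! * (l + n) !) (2 ^ (l + n) * poch (suc n) (2 * l)) (suc n) (λ i i<1+n → summand-factorisation l n i (s≤s⁻¹ i<1+n)) ⟩
  2 ^ (l + n) * poch (suc n) (2 * l) * reducedSum l n
    ∎

A-factorisation : ∀ l n → A l (l + n) ≡ 2 ^ l * poch (suc n) (2 * l) * reducedSum l n
A-factorisation l n = begin
  A l (l + n)                           ≡⟨ cong (_/ 2 ^ (l + n ∸ l)) (trans (numerator-factorisation l n) split) ⟩
  B * 2 ^ (l + n ∸ l) / 2 ^ (l + n ∸ l) ≡⟨ m*n/n≡m B (2 ^ (l + n ∸ l)) ⟩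
  B                                     ∎
  where
  instance _ = m^n≢0 2 (l + n ∸ l)
  P = poch (suc n) (2 * l)
  B = 2 ^ l * P * reducedSum l n
  split : 2 ^ (l + n) * P * reducedSum l n ≡ B * 2 ^ (l + n ∸ l)
  split = begin
    2 ^ (l + n) * P * reducedSum l n         ≡⟨ cong (λ x → x * P * reducedSum l n) (^-distribˡ-+-* 2 l n) ⟩
    2 ^ l * 2 ^ n * P * reducedSum l n       ≡⟨ rearrange (2 ^ l) (2 ^ n) P (reducedSum l n) ⟩
    B * 2 ^ n                                ≡⟨ cong (λ e → B * 2 ^ e) (m+n∸m≡n l n) ⟨
    B * 2 ^ (l + n ∸ l)                      ∎
    where
    rearrange : ∀ x y p s → x * y * p * s ≡ x * p * s * y
    rearrange = solve-∀

2∤oddFactorial : ∀ n → 2 ∤ oddFactorial n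
2∤oddFactorial zero    = >⇒∤ ≤-refl
2∤oddFactorial (suc n) = prime∤m∧∤n⇒∤m*n prime[2] (2∤oddFactorial n) (2∤1+2n n)

2∣poch[a,2+i] : ∀ a i → 2 ∣ poch a (2 + i)
2∣poch[a,2+i] a zero    = subst (2 ∣_) (expand a) (2∣n*[1+n] a)
  where
  expand : ∀ a → a * suc a ≡ 1 * (a + 0) * (a + 1)
  expand = solve-∀
2∣poch[a,2+i] a (suc i) = ∣m⇒∣m*n _ (2∣poch[a,2+i] a i)

2∤reducedSummand[0] : ∀ l n → 2 ∤ reducedSummand l n 0
2∤reducedSummand[0] l n = subst (2 ∤_) (sym (trans (*-identityʳ _) (*-identityʳ _))) (2∤oddFactorial n)

2∣reducedSummand[1+i] : ∀ l n i → 2 ∣ reducedSummand l n (suc i)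
2∣reducedSummand[1+i] l n zero    =
  subst (2 ∣_) (sym (*-assoc (oddFactorial (n ∸ 1)) (n C 1) _)) (∣n⇒∣m*n (oddFactorial (n ∸ 1)) 2∣nC1*poch)
  where
  expand : ∀ l n → n * suc n + 2 * (n * l) ≡ n * (1 * (suc (l + n + l) + 0))
  expand = solve-∀
  2∣nC1*poch : 2 ∣ (n C 1) * poch (suc (l + n + l)) 1
  2∣nC1*poch = subst (λ c → 2 ∣ c * poch (suc (l + n + l)) 1) (sym (nC1≡n n))
    (subst (2 ∣_) (expand l n) (∣m∣n⇒∣m+n (2∣n*[1+n] n) (m∣m*n (n * l))))
2∣reducedSummand[1+i] l n (suc i) = ∣n⇒∣m*n (oddFactorial (n ∸ (2 + i)) * (n C (2 + i))) (2∣poch[a,2+i] (suc (l + n + l)) i)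

reducedSum-odd : ∀ l n → 2 ∤ reducedSum l n
reducedSum-odd l n = sumBelow-odd n (2∤reducedSummand[0] l n) (λ i _ → 2∣reducedSummand[1+i] l n i)

theorem1p1 : (m l : ℕ) → 1 ≤ m → l ≤ m →
    (v : ℕ) → IsNu2 (poch (m + 1 ∸ l) (2 * l)) v → IsNu2 (A l m) (v + l)
theorem1p1 m l _ l≤m v ν₂[poch]≡v with m≤n⇒∃[o]m+o≡n l≤m
... | n , refl = subst (λ a → IsNu2 a (v + l)) (sym (A-factorisation l n))
  (IsNu2-*-odd {v = v + l} (IsNu2-2^l* {v = v} l ν₂[poch[1+n,2l]]≡v) (reducedSum-odd l n))
  where
  l+n+1∸l≡1+n : l + n + 1 ∸ l ≡ suc n
  l+n+1∸l≡1+n = trans (cong (_∸ l) (trans (+-assoc l n 1) (cong (l +_) (+-comm n 1)))) (m+n∸m≡n l (suc n))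
  ν₂[poch[1+n,2l]]≡v : IsNu2 (poch (suc n) (2 * l)) v
  ν₂[poch[1+n,2l]]≡v = subst (λ a → IsNu2 (poch a (2 * l)) v) l+n+1∸l≡1+n ν₂[poch]≡v
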